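{- Let $G$ be a bipartite graph. Let $P_1=(a_1,\dots,a_r,x_1,\dots,x_p,b_1,\dots,b_t)$ and $P_2=(b_t,\dots,b_1,y_d,\dots,y_1,a_r,\dots,a_1)$ be paths in $G$ (each a sequence of distinct vertices with consecutive vertices adjacent), with $r,t\ge1$, $p,d\ge0$, and $p\le d$, such that $\{x_1,\dots,x_p\}\cap\{y_1,\dots,y_d\}=\emptyset$ and $P_1$ and $P_2$ have no common vertices other than $a_1,\dots,a_r,b_1,\dots,b_t$ (i.e. $P_1,P_2$ are fully-merged with common prefix $A=(a_1,\dots,a_r)$ of $P_1$ and the reverse of $P_2$, and common suffix $B=(b_1,\dots,b_t)$). Suppose $P_1$ and $P_2$ are level-disjoint, i.e. for every $i\le\min(|V(P_1)|,|V(P_2)|)$ the $i$-th vertex of $P_1$ differs from the $i$-th vertex of $P_2$. Suppose further that $a_1$ and $b_t$ have a common neighbour $v$ that lies on neither $P_1$ nor $P_2$. Let $C$ be the cycle $(v,a_1,\dots,a_r,y_1,\dots,y_d,b_1,\dots,b_t,v)$ and let $P=(a_r,x_1,\dots,x_p,b_1)$. Then $P$ is a chordal path to $C$ that separates $v$ and $\overline{v}_C$.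
   Context: A path $P$ with endvertices $u,w$ is chordal to a cycle $C$ if $V(P)\cap V(C)=\{u,w\}$; such a path separates $x,y\in V(C)$ if $x$ and $y$ lie in different subpaths (components) of $C-\{u,w\}$. For an even cycle $C$ through $v$, $\overline{v}_C$ denotes the vertex of $C$ at distance $|C|/2$ from $v$ along $C$. The length of a path or cycle is its number of edges. -}

module Defs where

open import Data.Bool.Base using (Bool)
open import Data.Nat.Base using (ℕ; _<_; _+_; ⌊_/2⌋)
open import Data.Fin.Base using (Fin; toℕ)
open import Data.List.Base using (List; []; _∷_; length; lookup; head; last)
open import Data.List.Membership.Propositional using (_∈_)
open import Data.List.Relation.Unary.Unique.Propositional using (Unique)
open import Data.List.Relation.Unary.Linked using (Linked)
open import Data.Maybe.Base using (just)
open import Data.Product using (Σ; ∃; ∃-syntax; _×_)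
open import Data.Sum.Base using (_⊎_)
open import Relation.Nullary using (¬_)
open import Relation.Binary.PropositionalEquality using (_≡_; _≢_)

Symmetric : {V : Set} → (V → V → Set) → Set
Symmetric {V} E = ∀ {u w : V} → E u w → E w u

Bipartite : {V : Set} → (V → V → Set) → Set
Bipartite {V} E = Σ (V → Bool) λ col → ∀ {u w : V} → E u w → col u ≢ col w

IsPath : {V : Set} → (V → V → Set) → List V → Set
IsPath E P = Unique P × Linked E P

Chordal : {V : Set} → (V → V → Set) → List V → List V → Set
Chordal {V} E P C =
  IsPath E P ×
  ∃[ u ] ∃[ w ] (head P ≡ just u × last P ≡ just w × u ≢ w × u ∈ C × w ∈ C ×
    (∀ (z : V) → z ∈ P → z ∈ C → z ≡ u ⊎ z ≡ w))

-- A cycle is given by the list of its vertices in cyclic order (the edge from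
-- the last back to the first vertex is implicit).  Position k lies strictly
-- inside the arc between positions i and j (not passing through index 0/end).
InArc : ℕ → ℕ → ℕ → Set
InArc i j k = (i < k × k < j) ⊎ (j < k × k < i)

-- Removing u, w from the cycle C leaves the two arcs (components) of C - {u,w};
-- s and t lie in different components.
Separates : {V : Set} → List V → V → V → V → V → Set
Separates C u w s t =
  Σ (Fin (length C)) λ i → Σ (Fin (length C)) λ j →
  Σ (Fin (length C)) λ k → Σ (Fin (length C)) λ l →
    lookup C i ≡ u × lookup C j ≡ w × lookup C k ≡ s × lookup C l ≡ t ×
    i ≢ j × k ≢ i × k ≢ j × l ≢ i × l ≢ j ×
    ((InArc (toℕ i) (toℕ j) (toℕ k) × ¬ InArc (toℕ i) (toℕ j) (toℕ l)) ⊎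
     (¬ InArc (toℕ i) (toℕ j) (toℕ k) × InArc (toℕ i) (toℕ j) (toℕ l)))

-- z is the vertex of the cycle C at distance |C|/2 from v along C
-- (|C| = number of edges = number of vertices of the list C).
Opposite : {V : Set} → List V → V → V → Set
Opposite C v z =
  Σ (Fin (length C)) λ i → Σ (Fin (length C)) λ j →
    lookup C i ≡ v × lookup C j ≡ z ×
    (toℕ j ≡ toℕ i + ⌊ length C /2⌋ ⊎ toℕ j + length C ≡ toℕ i + ⌊ length C /2⌋)

-- As a₁ and bₜ have the common neighbour v, they have the same colour, so P₁ and P₂
-- have odd orders 2q+1 and 2k+1. Then C has 2k+2 vertices, and the vertex opposite to v is entry k
-- (counting from 0) of a ++ y ++ b. Level-disjointness puts this entry inside y: if k < r, entry k of a
-- is entry k of P₁ and, read from the other end, also entry k of P₂; if k ≥ r + d, then p ≤ d gives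
-- r + p ≤ q, so entry q of P₁ lies in b and is entry q of P₂ as well. Hence aᵣ and b₁ split C into an
-- arc through v and an arc through its opposite vertex.
module Submission where

open import Defs
open import Data.Nat.Base using (ℕ; zero; suc; _≤_; _<_; _+_; ⌊_/2⌋; s≤s; z<s)
open import Data.Nat.Properties
open import Data.Nat.GeneralisedArithmetic using (iterate)
open import Data.Nat.Tactic.RingSolver using (solve-∀)
open import Data.Bool.Base using (Bool; not)
open import Data.Bool.Properties using (not-involutive; not-¬; ¬-not)
open import Data.Fin.Base using (Fin; toℕ; zero; suc)
open import Data.List.Base using (List; []; _∷_; _++_; _∷ʳ_; [_]; reverse; length; lookup; head; last)
open import Data.List.Properties
  using (length-++; length-reverse; ++-assoc; unfold-reverse; reverse-++; reverse-involutive)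
open import Data.List.Membership.Propositional using (_∈_; _∉_)
open import Data.List.Membership.Propositional.Properties using (∈-++⁺ˡ; ∈-++⁺ʳ; ∈-++⁻; ∈-lookup)
open import Data.List.Relation.Unary.Any using (here; there)
open import Data.List.Relation.Unary.Any.Properties using (reverse⁺)
import Data.List.Relation.Unary.All as All
import Data.List.Relation.Unary.All.Properties as All
open import Data.List.Relation.Unary.AllPairs using (_∷_; [])
open import Data.List.Relation.Unary.Unique.Propositional using (Unique)
open import Data.List.Relation.Unary.Linked using (Linked; []; [-]; _∷_)
open import Data.Maybe.Base using (just)
open import Data.Product using (Σ; ∃; _×_; _,_; proj₁; proj₂)
open import Data.Sum.Base using (_⊎_; inj₁; inj₂)
open import Data.Empty using (⊥-elim)
open import Relation.Nullary using (¬_)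
open import Relation.Binary.PropositionalEquality hiding ([_])

private
  variable
    A : Set
    i j m n : ℕ
    u w z : A
    xs ys zs : List A

data _[_]=_ {A : Set} : List A → ℕ → A → Set where
  here  : (z ∷ xs) [ 0 ]= z
  there : xs [ n ]= z → (u ∷ xs) [ suc n ]= z

[]=-++⁺ˡ : xs [ n ]= z → (xs ++ ys) [ n ]= z
[]=-++⁺ˡ here      = here
[]=-++⁺ˡ (there p) = there ([]=-++⁺ˡ p)

[]=-++⁺ʳ : (xs : List A) → ys [ n ]= z → (xs ++ ys) [ length xs + n ]= z
[]=-++⁺ʳ []       p = p
[]=-++⁺ʳ (x ∷ xs) p = there ([]=-++⁺ʳ xs p)

[]=-reverse⁺ : xs [ j ]= z → suc (i + j) ≡ length xs → reverse xs [ i ]= z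
[]=-reverse⁺ {xs = x ∷ xs} {i = i} here eq rewrite unfold-reverse x xs =
  subst (λ n → (reverse xs ∷ʳ x) [ n ]= x) i≡ ([]=-++⁺ʳ (reverse xs) here)
  where
  open ≡-Reasoning
  i≡ : length (reverse xs) + 0 ≡ i
  i≡ = begin
    length (reverse xs) + 0 ≡⟨ +-identityʳ _ ⟩
    length (reverse xs)     ≡⟨ length-reverse xs ⟩
    length xs               ≡⟨ suc-injective eq ⟨
    i + 0                   ≡⟨ +-identityʳ i ⟩
    i                       ∎
[]=-reverse⁺ {xs = x ∷ xs} {i = i} (there {n = j} p) eq rewrite unfold-reverse x xs =
  []=-++⁺ˡ ([]=-reverse⁺ p (suc-injective (trans (cong suc (sym (+-suc i j))) eq)))

[]=-lookup : (xs : List A) (i : Fin (length xs)) → xs [ toℕ i ]= lookup xs i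
[]=-lookup (x ∷ xs) zero    = here
[]=-lookup (x ∷ xs) (suc i) = there ([]=-lookup xs i)

[]=⇒lookup : xs [ n ]= z → Σ (Fin (length xs)) λ i → toℕ i ≡ n × lookup xs i ≡ z
[]=⇒lookup here      = zero , refl , refl
[]=⇒lookup (there p) with []=⇒lookup p
... | i , refl , eq = suc i , refl , eq

<length⇒[]= : (xs : List A) → n < length xs → ∃ (xs [ n ]=_)
<length⇒[]= {n = zero}  (x ∷ xs) _         = x , here
<length⇒[]= {n = suc n} (x ∷ xs) (s≤s n<) = let z , p = <length⇒[]= xs n< in z , there p

head⇒[]= : ∀ (xs : List A) → head xs ≡ just z → xs [ 0 ]= z
head⇒[]= (x ∷ xs) refl = here

last⇒[]= : ∀ (xs : List A) → last xs ≡ just z → ∃ λ n → suc n ≡ length xs × xs [ n ]= z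
last⇒[]= (x ∷ [])     refl = 0 , refl , here
last⇒[]= (x ∷ y ∷ xs) eq   = let n , len , p = last⇒[]= (y ∷ xs) eq in suc n , cong suc len , there p

last⇒∷ʳ : ∀ (xs : List A) → last xs ≡ just z → ∃ λ ys → xs ≡ ys ∷ʳ z
last⇒∷ʳ (x ∷ [])     refl = [] , refl
last⇒∷ʳ (x ∷ y ∷ xs) eq   = let ys , eq′ = last⇒∷ʳ (y ∷ xs) eq in x ∷ ys , cong (x ∷_) eq′

head⇒∷ : ∀ (xs : List A) → head xs ≡ just z → ∃ λ ys → xs ≡ z ∷ ys
head⇒∷ (x ∷ xs) refl = xs , refl

last-∷ʳ : ∀ (xs : List A) → last (xs ∷ʳ z) ≡ just z
last-∷ʳ []           = refl
last-∷ʳ (x ∷ [])     = refl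
last-∷ʳ (x ∷ y ∷ xs) = last-∷ʳ (y ∷ xs)

head-++ : ∀ (xs : List A) → head xs ≡ just z → head (xs ++ ys) ≡ just z
head-++ (x ∷ xs) eq = eq

last-++ : ∀ (xs : List A) → last ys ≡ just z → last (xs ++ ys) ≡ just z
last-++ {ys = ys} {z = z} xs eq with ys′ , refl ← last⇒∷ʳ ys eq =
  subst (λ l → last l ≡ just z) (++-assoc xs ys′ [ z ]) (last-∷ʳ (xs ++ ys′))

head-reverse : ∀ (xs : List A) → last xs ≡ just z → head (reverse xs) ≡ just z
head-reverse {z = z} xs eq with xs′ , refl ← last⇒∷ʳ xs eq =
  cong head (reverse-++ xs′ [ z ])

last-reverse : ∀ (xs : List A) → head xs ≡ just z → last (reverse xs) ≡ just z
last-reverse (x ∷ xs) refl =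
  subst (λ l → last l ≡ just x) (sym (unfold-reverse x xs)) (last-∷ʳ (reverse xs))

Unique-++⁻ˡ : ∀ (xs : List A) → Unique (xs ++ ys) → Unique xs
Unique-++⁻ˡ []       _          = []
Unique-++⁻ˡ (x ∷ xs) (x∉ ∷ uxs) = All.++⁻ˡ xs x∉ ∷ Unique-++⁻ˡ xs uxs

Unique-++⁻ʳ : ∀ (xs : List A) → Unique (xs ++ ys) → Unique ys
Unique-++⁻ʳ []       u         = u
Unique-++⁻ʳ (x ∷ xs) (_ ∷ uxs) = Unique-++⁻ʳ xs uxs

Unique-++⇒disjoint : ∀ (xs : List A) → Unique (xs ++ ys) → z ∈ xs → z ∉ ys
Unique-++⇒disjoint (x ∷ xs) (x∉ ∷ _)   (here refl) z∈ys = All.lookup x∉ (∈-++⁺ʳ xs z∈ys) refl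
Unique-++⇒disjoint (x ∷ xs) (_ ∷ uxs) (there z∈xs) z∈ys = Unique-++⇒disjoint xs uxs z∈xs z∈ys

module _ {R : A → A → Set} where

  Linked-++⁻ˡ : ∀ (xs : List A) → Linked R (xs ++ ys) → Linked R xs
  Linked-++⁻ˡ []           _       = []
  Linked-++⁻ˡ (x ∷ [])     _       = [-]
  Linked-++⁻ˡ (x ∷ y ∷ xs) (r ∷ l) = r ∷ Linked-++⁻ˡ (y ∷ xs) l

  Linked-++⁻ʳ : ∀ (xs : List A) → Linked R (xs ++ ys) → Linked R ys
  Linked-++⁻ʳ []           l       = l
  Linked-++⁻ʳ (x ∷ [])     [-]     = []
  Linked-++⁻ʳ (x ∷ [])     (_ ∷ l) = l
  Linked-++⁻ʳ (x ∷ y ∷ xs) (_ ∷ l) = Linked-++⁻ʳ (y ∷ xs) l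

IsPath-infix : {E : A → A → Set} (xs ys : List A) → IsPath E (xs ++ ys ++ zs) → IsPath E ys
IsPath-infix xs ys (u , l) =
  Unique-++⁻ˡ ys (Unique-++⁻ʳ xs u) , Linked-++⁻ˡ ys (Linked-++⁻ʳ xs l)

LevelDisjoint : List A → List A → Set
LevelDisjoint xs ys =
  ∀ (i : Fin (length xs)) (j : Fin (length ys)) → toℕ i ≡ toℕ j → lookup xs i ≢ lookup ys j

LevelDisjoint-sym : LevelDisjoint xs ys → LevelDisjoint ys xs
LevelDisjoint-sym disj i j i≡j eq = disj j i (sym i≡j) (sym eq)

LevelDisjoint⇒≢ : LevelDisjoint xs ys → xs [ n ]= z → ¬ ys [ n ]= z
LevelDisjoint⇒≢ disj p q with []=⇒lookup p | []=⇒lookup q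
... | i , refl , refl | j , i≡j , eq = disj i j (sym i≡j) (sym eq)

¬LevelDisjoint-mirror : ∀ (as xs ys : List A) →
                        length ys ≤ m → length (ys ++ reverse as) ≡ suc (m + m) →
                        ¬ LevelDisjoint (as ++ xs) (ys ++ reverse as)
¬LevelDisjoint-mirror as xs ys ys≤m len disj with m≤n⇒∃[o]m+o≡n ys≤m
... | i , refl =
  let z , p = <length⇒[]= as (subst (level <_) as≡ (s≤s (m≤n+m level i)))
  in LevelDisjoint⇒≢ disj ([]=-++⁺ˡ p) ([]=-++⁺ʳ ys ([]=-reverse⁺ p as≡))
  where
  level = length ys + i
  open ≡-Reasoning
  as≡ : suc (i + level) ≡ length as
  as≡ = +-cancelˡ-≡ (length ys) _ _ (begin
    length ys + suc (i + level)     ≡⟨ +-suc (length ys) (i + level) ⟩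
    suc (length ys + (i + level))   ≡⟨ cong suc (+-assoc (length ys) i level) ⟨
    suc (level + level)             ≡⟨ len ⟨
    length (ys ++ reverse as)       ≡⟨ length-++ ys ⟩
    length ys + length (reverse as) ≡⟨ cong (length ys +_) (length-reverse as) ⟩
    length ys + length as           ∎)

iterate-not-fixed⇒even : ∀ c n → iterate not c n ≡ c → ∃ λ k → n ≡ k + k
iterate-not-fixed⇒even c zero          _  = 0 , refl
iterate-not-fixed⇒even c (suc zero)    eq = ⊥-elim (not-¬ refl (sym eq))
iterate-not-fixed⇒even c (suc (suc n)) eq rewrite not-involutive c =
  let k , n≡k+k = iterate-not-fixed⇒even c n eq in
  suc k , cong suc (trans (cong suc n≡k+k) (sym (+-suc k k)))

module BipartiteWalk {E : A → A → Set} (col : A → Bool) (proper : ∀ {u w} → E u w → col u ≢ col w)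
  where

  colour-along : Linked E xs → xs [ 0 ]= u → xs [ n ]= w → col w ≡ iterate not (col u) n
  colour-along _       here here      = refl
  colour-along (e ∷ l) here (there {n = n} p) =
    trans (colour-along l here p) (cong (λ c → iterate not c n) (¬-not (λ eq → proper e (sym eq))))

  same-colour⇒even : Linked E xs → xs [ 0 ]= u → xs [ n ]= w → col u ≡ col w → ∃ λ k → n ≡ k + k
  same-colour⇒even l p q eq = iterate-not-fixed⇒even _ _ (trans (sym (colour-along l p q)) (sym eq))

  common-neighbour⇒odd : ∀ {v} → E v u → E v w →
                         Linked E xs → head xs ≡ just u → last xs ≡ just w →
                         ∃ λ k → length xs ≡ suc (k + k)
  common-neighbour⇒odd v-u v-w l head-xs last-xs =
    let n , n+1≡len , p = last⇒[]= _ last-xs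
        k , n≡k+k = same-colour⇒even l (head⇒[]= _ head-xs) p
                      (trans (¬-not (≢-sym (proper v-u))) (sym (¬-not (≢-sym (proper v-w)))))
    in k , trans (sym n+1≡len) (cong suc n≡k+k)

suc[k+k]≡m+n∧k<m⇒n≤k : ∀ {k} → suc (k + k) ≡ m + n → k < m → n ≤ k
suc[k+k]≡m+n∧k<m⇒n≤k {m} {n} {k} eq k<m = +-cancelˡ-≤ m n k (begin
  m + n       ≡⟨ eq ⟨
  suc k + k   ≤⟨ +-monoˡ-≤ k k<m ⟩
  m + k       ∎)
  where open ≤-Reasoning

k+k<n+n⇒k<n : ∀ {k} → k + k < n + n → k < n
k+k<n+n⇒k<n lt = ≰⇒> (λ n≤k → <⇒≱ lt (+-mono-≤ n≤k n≤k))

opposite-of-head : ∀ {v : A} {k} cs → v ∉ cs → length cs ≡ suc (k + k) →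
                   Opposite (v ∷ cs) v z → (v ∷ cs) [ suc k ]= z
opposite-of-head cs v∉cs len (suc i , _ , v≡ , _) = ⊥-elim (v∉cs (subst (_∈ cs) v≡ (∈-lookup i)))
opposite-of-head {v = v} {k} cs v∉cs len (zero , j , refl , z≡ , inj₁ j≡) =
  subst₂ (λ n y → (v ∷ cs) [ n ]= y) (trans j≡ half) z≡ ([]=-lookup (v ∷ cs) j)
  where
  half : ⌊ length (v ∷ cs) /2⌋ ≡ suc k
  half = trans (cong (λ n → ⌊ suc n /2⌋) len) (cong suc (sym (n≡⌊n+n/2⌋ k)))
opposite-of-head {v = v} cs v∉cs len (zero , j , refl , z≡ , inj₂ j≡) =
  ⊥-elim (<⇒≱ (⌊n/2⌋<n (length cs)) (subst (length (v ∷ cs) ≤_) j≡ (m≤n+m _ (toℕ j))))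

separates-head : ∀ {v : A} {cs u w s i j l} →
                 (v ∷ cs) [ i ]= u → (v ∷ cs) [ j ]= w → (v ∷ cs) [ l ]= s →
                 0 < i → i < l → l < j → Separates (v ∷ cs) u w v s
separates-head pu pw ps 0<i i<l l<j
  with I , refl , refl ← []=⇒lookup pu
     | J , refl , refl ← []=⇒lookup pw
     | L , refl , refl ← []=⇒lookup ps
  = I , J , zero , L , refl , refl , refl , refl ,
    apart (<-trans i<l l<j) , apart 0<i , apart (<-trans 0<i (<-trans i<l l<j)) ,
    ≢-sym (apart i<l) , apart l<j ,
    inj₂ ((λ { (inj₁ (() , _)) ; (inj₂ (() , _)) }) , inj₁ (i<l , l<j))
  where
  apart : ∀ {n} {a b : Fin n} → toℕ a < toℕ b → a ≢ b
  apart lt eq = <-irrefl (cong toℕ eq) lt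

middle-∉-cycle : ∀ {v : A} as {xs} bs {ys} → Unique (as ++ xs ++ bs) → v ∉ as ++ xs ++ bs →
                 (∀ z → z ∈ xs → z ∉ ys) → z ∈ xs → z ∉ v ∷ as ++ ys ++ bs
middle-∉-cycle as bs u v∉ xs∩ys z∈xs (here refl) = v∉ (∈-++⁺ʳ as (∈-++⁺ˡ z∈xs))
middle-∉-cycle as bs u v∉ xs∩ys z∈xs (there z∈) with ∈-++⁻ as z∈
... | inj₁ z∈as = Unique-++⇒disjoint as u z∈as (∈-++⁺ˡ z∈xs)
... | inj₂ z∈ys++bs with ∈-++⁻ _ z∈ys++bs
...   | inj₁ z∈ys = xs∩ys _ z∈xs z∈ys
...   | inj₂ z∈bs = Unique-++⇒disjoint _ (Unique-++⁻ʳ as u) z∈xs z∈bs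

middle-path-chordal : ∀ {E : A → A → Set} {v aᵣ b₁ : A} as xs bs ys →
                      last as ≡ just aᵣ → head bs ≡ just b₁ → IsPath E (as ++ xs ++ bs) →
                      v ∉ as ++ xs ++ bs → (∀ z → z ∈ xs → z ∉ ys) →
                      Chordal E (aᵣ ∷ xs ++ b₁ ∷ []) (v ∷ as ++ ys ++ bs)
middle-path-chordal {aᵣ = aᵣ} {b₁} as xs bs ys last-as head-bs path v∉ xs∩ys
  with as′ , refl ← last⇒∷ʳ as last-as
     | bs′ , refl ← head⇒∷ bs head-bs
  = subpath , aᵣ , b₁ , refl , last-∷ʳ (aᵣ ∷ xs) , aᵣ≢b₁ , aᵣ∈C , b₁∈C , ends-only
  where
  open ≡-Reasoning
  subpath : IsPath _ (aᵣ ∷ xs ++ b₁ ∷ [])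
  subpath = IsPath-infix as′ (aᵣ ∷ xs ++ b₁ ∷ []) (subst (IsPath _) (begin
    (as′ ∷ʳ aᵣ) ++ xs ++ b₁ ∷ bs′          ≡⟨ ++-assoc as′ [ aᵣ ] _ ⟩
    as′ ++ aᵣ ∷ xs ++ b₁ ∷ bs′             ≡⟨ cong (λ l → as′ ++ aᵣ ∷ l) (++-assoc xs [ b₁ ] bs′) ⟨
    as′ ++ (aᵣ ∷ xs ++ b₁ ∷ []) ++ bs′     ∎) path)
  aᵣ≢b₁ : aᵣ ≢ b₁
  aᵣ≢b₁ with aᵣ∉ ∷ _ ← proj₁ subpath = All.lookup aᵣ∉ (∈-++⁺ʳ xs (here refl))
  aᵣ∈C : aᵣ ∈ _ ∷ (as′ ∷ʳ aᵣ) ++ ys ++ b₁ ∷ bs′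
  aᵣ∈C = there (∈-++⁺ˡ (∈-++⁺ʳ as′ (here refl)))
  b₁∈C : b₁ ∈ _ ∷ (as′ ∷ʳ aᵣ) ++ ys ++ b₁ ∷ bs′
  b₁∈C = there (∈-++⁺ʳ (as′ ∷ʳ aᵣ) (∈-++⁺ʳ ys (here refl)))
  ends-only : ∀ z → z ∈ aᵣ ∷ xs ++ b₁ ∷ [] → z ∈ _ ∷ (as′ ∷ʳ aᵣ) ++ ys ++ b₁ ∷ bs′ →
              z ≡ aᵣ ⊎ z ≡ b₁
  ends-only z (here z≡aᵣ) _ = inj₁ z≡aᵣ
  ends-only z (there z∈) z∈C with ∈-++⁻ xs z∈
  ... | inj₁ z∈xs        = ⊥-elim (middle-∉-cycle (as′ ∷ʳ aᵣ) (b₁ ∷ bs′) (proj₁ path) v∉ xs∩ys z∈xs z∈C)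
  ... | inj₂ (here z≡b₁) = inj₂ z≡b₁

∉-merged : ∀ as xs bs ys → z ∉ as ++ xs ++ bs → z ∉ reverse bs ++ reverse ys ++ reverse as →
           z ∉ as ++ ys ++ bs
∉-merged as xs bs ys z∉₁ z∉₂ z∈ with ∈-++⁻ as z∈
... | inj₁ z∈as = z∉₁ (∈-++⁺ˡ z∈as)
... | inj₂ z∈ys++bs with ∈-++⁻ ys z∈ys++bs
...   | inj₁ z∈ys = z∉₂ (∈-++⁺ʳ (reverse bs) (∈-++⁺ˡ (reverse⁺ z∈ys)))
...   | inj₂ z∈bs = z∉₁ (∈-++⁺ʳ as (∈-++⁺ʳ xs z∈bs))

length-reverse-++ : ∀ (xs ys : List A) → length (reverse xs ++ reverse ys) ≡ length xs + length ys
length-reverse-++ xs ys = trans (length-++ (reverse xs)) (cong₂ _+_ (length-reverse xs) (length-reverse ys))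

opposite-inside : ∀ (as xs bs ys : List A) {q k} → length xs ≤ length ys →
                  length (as ++ xs ++ bs) ≡ suc (q + q) →
                  length (reverse bs ++ reverse ys ++ reverse as) ≡ suc (k + k) →
                  LevelDisjoint (as ++ xs ++ bs) (reverse bs ++ reverse ys ++ reverse as) →
                  length as ≤ k × k < length as + length ys
opposite-inside as xs bs ys {q} {k} p≤d len₁ len₂ disj = r≤k , k<r+d
  where
  r = length as
  p = length xs
  t = length bs
  d = length ys
  P₁ = as ++ xs ++ bs
  P₂ = reverse bs ++ reverse ys ++ reverse as

  P₁≡ : (as ++ xs) ++ reverse (reverse bs) ≡ P₁
  P₁≡ = trans (cong ((as ++ xs) ++_) (reverse-involutive bs)) (++-assoc as xs bs)

  P₂≡ : (reverse bs ++ reverse ys) ++ reverse as ≡ P₂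
  P₂≡ = ++-assoc (reverse bs) (reverse ys) (reverse as)

  odd₁ : suc (q + q) ≡ (r + p) + t
  odd₁ = begin
    suc (q + q)          ≡⟨ len₁ ⟨
    length P₁            ≡⟨ length-++ as ⟩
    r + length (xs ++ bs) ≡⟨ cong (r +_) (length-++ xs) ⟩
    r + (p + t)          ≡⟨ +-assoc r p t ⟨
    (r + p) + t          ∎
    where open ≡-Reasoning

  odd₂ : suc (k + k) ≡ (t + d) + r
  odd₂ = begin
    suc (k + k)                                             ≡⟨ len₂ ⟨
    length P₂                                               ≡⟨ cong length P₂≡ ⟨
    length ((reverse bs ++ reverse ys) ++ reverse as)       ≡⟨ length-++ (reverse bs ++ reverse ys) ⟩
    length (reverse bs ++ reverse ys) + length (reverse as) ≡⟨ cong₂ _+_ (length-reverse-++ bs ys) (length-reverse as) ⟩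
    (t + d) + r                                             ∎
    where open ≡-Reasoning

  k<t+d : k < t + d
  k<t+d = ≰⇒> λ t+d≤k → ¬LevelDisjoint-mirror as (xs ++ bs) (reverse bs ++ reverse ys)
    (subst (_≤ k) (sym (length-reverse-++ bs ys)) t+d≤k)
    (trans (cong length P₂≡) len₂)
    (subst (LevelDisjoint P₁) (sym P₂≡) disj)

  r≤k : r ≤ k
  r≤k = suc[k+k]≡m+n∧k<m⇒n≤k odd₂ k<t+d

  q<r+p : q < r + p
  q<r+p = ≰⇒> λ r+p≤q → ¬LevelDisjoint-mirror (reverse bs) (reverse ys ++ reverse as) (as ++ xs)
    (subst (_≤ q) (sym (length-++ as)) r+p≤q)
    (trans (cong length P₁≡) len₁)
    (subst (LevelDisjoint P₂) (sym P₁≡) (LevelDisjoint-sym {xs = P₁} {ys = P₂} disj))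

  t≤q : t ≤ q
  t≤q = suc[k+k]≡m+n∧k<m⇒n≤k odd₁ q<r+p

  k<r+d : k < r + d
  k<r+d = k+k<n+n⇒k<n (begin-strict
    k + k             <⟨ n<1+n (k + k) ⟩
    suc (k + k)       ≡⟨ odd₂ ⟩
    (t + d) + r       <⟨ +-monoˡ-< r (+-monoˡ-< d (≤-<-trans t≤q q<r+p)) ⟩
    ((r + p) + d) + r ≤⟨ +-monoˡ-≤ r (+-monoˡ-≤ d (+-monoʳ-≤ r p≤d)) ⟩
    ((r + d) + d) + r ≡⟨ +-assoc (r + d) d r ⟩
    (r + d) + (d + r) ≡⟨ cong ((r + d) +_) (+-comm d r) ⟩
    (r + d) + (r + d) ∎)
    where open ≤-Reasoning

length-merged : ∀ (as ys bs : List A) →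
                length (as ++ ys ++ bs) ≡ length (reverse bs ++ reverse ys ++ reverse as)
length-merged as ys bs
  rewrite length-++ as {ys ++ bs} | length-++ ys {bs}
        | length-++ (reverse bs) {reverse ys ++ reverse as} | length-++ (reverse ys) {reverse as}
        | length-reverse as | length-reverse ys | length-reverse bs = rearrange (length as) (length ys) (length bs)
  where
  rearrange : ∀ r d t → r + (d + t) ≡ t + (d + r)
  rearrange = solve-∀

separates-opposite : ∀ {v aᵣ b₁ : A} as bs ys {k} → last as ≡ just aᵣ → head bs ≡ just b₁ →
                     v ∉ as ++ ys ++ bs → length (as ++ ys ++ bs) ≡ suc (k + k) →
                     length as ≤ k → k < length as + length ys →
                     ∀ z → Opposite (v ∷ as ++ ys ++ bs) v z →
                     Separates (v ∷ as ++ ys ++ bs) aᵣ b₁ v z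
separates-opposite as bs ys {k} last-as head-bs v∉ len r≤k k<r+d z opp =
  let r₀ , r₀+1≡r , aᵣ-at = last⇒[]= as last-as in
  separates-head
    (there ([]=-++⁺ˡ aᵣ-at))
    (there ([]=-++⁺ʳ as ([]=-++⁺ʳ ys (head⇒[]= bs head-bs))))
    (opposite-of-head (as ++ ys ++ bs) v∉ len opp)
    z<s
    (s≤s (subst (_≤ k) (sym r₀+1≡r) r≤k))
    (s≤s (subst (k <_) (cong (length as +_) (sym (+-identityʳ (length ys)))) k<r+d))

lemma5 : {V : Set} (E : V → V → Set) → Symmetric E → Bipartite E →
    (a x b y : List V) (a₁ aᵣ b₁ bₜ v : V) →
    head a ≡ just a₁ → last a ≡ just aᵣ → head b ≡ just b₁ → last b ≡ just bₜ →
    length x ≤ length y →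
    IsPath E (a ++ x ++ b) →
    IsPath E (reverse b ++ reverse y ++ reverse a) →
    (∀ z → z ∈ x → z ∉ y) →
    (∀ z → z ∈ a ++ x ++ b → z ∈ reverse b ++ reverse y ++ reverse a → z ∈ a ⊎ z ∈ b) →
    (∀ (i : Fin (length (a ++ x ++ b))) (j : Fin (length (reverse b ++ reverse y ++ reverse a))) →
      toℕ i ≡ toℕ j → lookup (a ++ x ++ b) i ≢ lookup (reverse b ++ reverse y ++ reverse a) j) →
    E v a₁ → E v bₜ →
    v ∉ a ++ x ++ b → v ∉ reverse b ++ reverse y ++ reverse a →
    Chordal E (aᵣ ∷ x ++ b₁ ∷ []) (v ∷ a ++ y ++ b) ×
    (∀ z → Opposite (v ∷ a ++ y ++ b) v z → Separates (v ∷ a ++ y ++ b) aᵣ b₁ v z)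
lemma5 E _ (col , proper) a x b y a₁ aᵣ b₁ bₜ v head-a last-a head-b last-b p≤d
       path₁ path₂ x∩y _ level-disjoint v-a₁ v-bₜ v∉P₁ v∉P₂ =
  let open BipartiteWalk col proper
      q , len₁ = common-neighbour⇒odd v-a₁ v-bₜ (proj₂ path₁)
                   (head-++ a head-a)
                   (last-++ a (last-++ x last-b))
      k , len₂ = common-neighbour⇒odd v-bₜ v-a₁ (proj₂ path₂)
                   (head-++ (reverse b) (head-reverse b last-b))
                   (last-++ (reverse b) (last-++ (reverse y) (last-reverse a head-a)))
      r≤k , k<r+d = opposite-inside a x b y {q} {k} p≤d len₁ len₂ level-disjoint
  in middle-path-chordal a x b y last-a head-b path₁ v∉P₁ x∩y ,
     separates-opposite a b y {k} last-a head-b (∉-merged a x b y v∉P₁ v∉P₂)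
                        (trans (length-merged a y b) len₂) r≤k k<r+d
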